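{- Let $m$ be a positive integer and let $h,k$ be integers with $0\le h\le m$ and $0\le k\le m$. Then the coefficient of $q^{m^2-h}$ in the polynomial $(-1)^m q^{\frac{m(m-1)}{2}}\prod_{j=0}^{m-1-k}\left(1-q^{m-j}\right)$ equals the parity-count of $\mathcal{D}_2(h,k,\star)$.
   Context: A $2$-distinct partition of $n$ is a partition of $n$ (the empty partition allowed) whose parts are split between two (possibly empty) labelled subsets, "red" and "white", with the parts in each subset pairwise distinct. $\mathcal{D}_2(n,j,\star)$ is the set of $2$-distinct partitions of $n$ whose red subset has exactly $j$ parts. The parity-count of a set of partitions is the number of its partitions with an even total number of parts minus the number with an odd total number of parts. An empty product equals $1$. -}

module Defs where

open import Data.Bool using (Bool; true; false; if_then_else_)
open import Data.Nat as ℕ using (ℕ; zero; suc; _∸_; _≟_)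
open import Data.Nat.DivMod using (_/_)
open import Data.Integer as ℤ using (ℤ; +_; -_)
open import Data.List using (List; []; _∷_; _++_; map; filter; upTo; foldr; cartesianProduct; allFin)
open import Data.Vec using (Vec; []; _∷_; lookup)
open import Data.Fin using (Fin; toℕ)
open import Data.Fin.Subset using (Subset; ∣_∣)
open import Data.Product using (_×_; _,_; proj₁; proj₂)
open import Relation.Nullary.Decidable using (_×-dec_)

-- Polynomials in q with integer coefficients, as coefficient lists
-- (head = coefficient of q^0).

Poly : Set
Poly = List ℤ

infixl 6 _⊕_
infixl 7 _⊗_

_⊕_ : Poly → Poly → Poly
[] ⊕ q = q
p ⊕ [] = p
(a ∷ p) ⊕ (b ∷ q) = (a ℤ.+ b) ∷ (p ⊕ q)

scale : ℤ → Poly → Poly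
scale c = map (c ℤ.*_)

_⊗_ : Poly → Poly → Poly
[] ⊗ q = []
(a ∷ p) ⊗ q = scale a q ⊕ (+ 0 ∷ (p ⊗ q))

const : ℤ → Poly
const c = c ∷ []

qPow : ℕ → Poly
qPow zero = + 1 ∷ []
qPow (suc n) = + 0 ∷ qPow n

coeff : ℕ → Poly → ℤ
coeff n [] = + 0
coeff zero (a ∷ p) = a
coeff (suc n) (a ∷ p) = coeff n p

polyProduct : List Poly → Poly
polyProduct = foldr _⊗_ (const (+ 1))

sgn : ℕ → ℤ
sgn zero = + 1
sgn (suc n) = - sgn n

-- The polynomial (-1)^m q^{m(m-1)/2} ∏_{j=0}^{m-1-k} (1 - q^{m-j})
-- (for k ≤ m the index j ranges over 0,1,...,m-k-1; empty product = 1).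
lemma4Poly : ℕ → ℕ → Poly
lemma4Poly m k =
  const (sgn m) ⊗ qPow ((m ℕ.* (m ∸ 1)) / 2)
    ⊗ polyProduct (map (λ j → const (+ 1) ⊕ const (- + 1) ⊗ qPow (m ∸ j)) (upTo (m ∸ k)))

-- Distinct partitions with all parts ≤ n, encoded as subsets of
-- {1,...,n}: position i (a Fin n) stands for the part toℕ i + 1.
-- Every part of a partition of n is ≤ n, so for partitions of n this
-- encoding is a bijection.

partSum : ∀ {n} → Subset n → ℕ
partSum {n} p = foldr ℕ._+_ 0
  (map (λ i → if lookup p i then suc (toℕ i) else 0) (allFin n))

numParts : ∀ {n} → Subset n → ℕ
numParts = ∣_∣

subsets : ∀ n → List (Subset n)
subsets zero = [] ∷ []
subsets (suc n) = map (false ∷_) (subsets n) ++ map (true ∷_) (subsets n)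

-- A 2-distinct partition (red, white) with parts ≤ n.
TwoDistinct : ℕ → Set
TwoDistinct n = Subset n × Subset n

D₂ : (n j : ℕ) → List (TwoDistinct n)
D₂ n j = filter (λ rw → (partSum (proj₁ rw) ℕ.+ partSum (proj₂ rw) ≟ n)
                         ×-dec (numParts (proj₁ rw) ≟ j))
                (cartesianProduct (subsets n) (subsets n))

totalParts : ∀ {n} → TwoDistinct n → ℕ
totalParts (r , w) = numParts r ℕ.+ numParts w

parityCount : ∀ {n} → List (TwoDistinct n) → ℤ
parityCount = foldr (λ rw acc → sgn (totalParts rw) ℤ.+ acc) (+ 0)

-- Write T k = k (k + 1) / 2.  Since m² = m (m - 1) / 2 + T m, the left side is
-- (-1)^m [q^{T m - h}] ∏_{k < i ≤ m} (1 - q^i).  Up to the sign (-1)^{m - k} this product is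
-- palindromic of degree T m - T k, so the left side is (-1)^k [q^{h - T k}] ∏_{i > k} (1 - q^i);
-- the factors with i > m do not matter because h ≤ m.  On the right, summing (-1)^{|w|} over
-- the white parts gives ∏_{i ≥ 1} (1 - q^i), so the parity-count is
-- (-1)^k [q^h] (Σ_r q^{|r|}) ∏_{i ≥ 1} (1 - q^i), r ranging over partitions into k distinct
-- parts, and Euler's identity Σ_r q^{|r|} = q^{T k} / ∏_{i ≤ k} (1 - q^i) identifies the two.

module Submission where

open import Data.Bool using (true; false; if_then_else_)
open import Data.Fin using (toℕ)
open import Data.Fin.Subset using (Subset; ∣_∣)
open import Data.Integer as ℤ using (ℤ; -_; 0ℤ; 1ℤ; -1ℤ)
import Data.Integer.Properties as ℤ
open import Data.Integer.Tactic.RingSolver using (solve-∀)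
open import Data.List
  using (List; []; _∷_; _++_; map; filter; foldr; cartesianProduct; tabulate; applyUpTo; upTo; length)
open import Data.List.Properties using (map-∘; map-tabulate; tabulate-cong; map-upTo)
open import Data.List.Relation.Binary.Permutation.Propositional
  using (_↭_; prep; swap; ↭-sym; ↭-trans; ↭-reflexive)
import Data.List.Relation.Binary.Permutation.Propositional as ↭
open import Data.Nat using (ℕ; zero; suc; _+_; _*_; _∸_; _≤_; _<_; z≤n; s≤s; _≟_; NonZero)
open import Data.Nat.DivMod using (_/_; m*n/n≡m)
open import Data.Nat.ListAction using (sum)
import Data.Nat.Properties as ℕ
open import Algebra.Properties.CommutativeSemigroup ℕ.+-commutativeSemigroup
  using () renaming (x∙yz≈y∙xz to x+[y+z]≡y+[x+z])
import Data.Nat.Tactic.RingSolver as ℕ-Solver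
open import Data.Product using (_×_; _,_; proj₁; proj₂)
open import Data.Vec using ([]; _∷_; lookup)
open import Function using (_∘_)
open import Relation.Binary.PropositionalEquality
  using (_≡_; refl; sym; trans; cong; cong₂; module ≡-Reasoning)
open import Relation.Nullary using (Dec; yes; no; does)
open import Relation.Nullary.Decidable using (_×-dec_)
open import Relation.Unary using (Decidable)

open import Defs

private
  variable
    A B : Set

sgn-+ : ∀ m n → sgn (m + n) ≡ sgn m ℤ.* sgn n
sgn-+ zero    n = sym (ℤ.*-identityˡ (sgn n))
sgn-+ (suc m) n = trans (cong -_ (sgn-+ m n)) (ℤ.neg-distribˡ-* (sgn m) (sgn n))

sgn*sgn : ∀ n → sgn n ℤ.* sgn n ≡ 1ℤ
sgn*sgn zero    = refl
sgn*sgn (suc n) = trans (neg*neg (sgn n)) (sgn*sgn n)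
  where
  neg*neg : ∀ s → - s ℤ.* - s ≡ s ℤ.* s
  neg*neg = solve-∀

sgn-+-cancelʳ : ∀ k t x → sgn (k + t) ℤ.* (sgn t ℤ.* x) ≡ sgn k ℤ.* x
sgn-+-cancelʳ k t x = begin
  sgn (k + t) ℤ.* (sgn t ℤ.* x)         ≡⟨ cong (ℤ._* (sgn t ℤ.* x)) (sgn-+ k t) ⟩
  sgn k ℤ.* sgn t ℤ.* (sgn t ℤ.* x)     ≡⟨ regroup (sgn k) (sgn t) x ⟩
  sgn k ℤ.* (sgn t ℤ.* sgn t) ℤ.* x     ≡⟨ cong (λ s → sgn k ℤ.* s ℤ.* x) (sgn*sgn t) ⟩
  sgn k ℤ.* 1ℤ ℤ.* x                    ≡⟨ cong (ℤ._* x) (ℤ.*-identityʳ (sgn k)) ⟩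
  sgn k ℤ.* x ∎
  where
  open ≡-Reasoning
  regroup : ∀ a b c → a ℤ.* b ℤ.* (b ℤ.* c) ≡ a ℤ.* (b ℤ.* b) ℤ.* c
  regroup = solve-∀

data Split (a : ℕ) : ℕ → Set where
  below : ∀ {n} → n < a → Split a n
  above : ∀ e → Split a (a + e)

split : ∀ a n → Split a n
split zero    n       = above n
split (suc a) zero    = below (s≤s z≤n)
split (suc a) (suc n) with split a n
... | below n<a = below (s≤s n<a)
... | above e   = above e

Series : Set
Series = ℕ → ℤ

shift : ℕ → Series → Series
shift zero    f n       = f n
shift (suc a) f zero    = 0ℤ
shift (suc a) f (suc n) = shift a f n

shift-+ : ∀ a b f n → shift (a + b) f n ≡ shift a (shift b f) n
shift-+ zero    b f n       = refl
shift-+ (suc a) b f zero    = refl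
shift-+ (suc a) b f (suc n) = shift-+ a b f n

shift-comm : ∀ a b f n → shift a (shift b f) n ≡ shift b (shift a f) n
shift-comm a b f n = trans (sym (shift-+ a b f n))
  (trans (cong (λ c → shift c f n) (ℕ.+-comm a b)) (shift-+ b a f n))

shift-cancel : ∀ a f n → shift a f (a + n) ≡ f n
shift-cancel zero    f n = refl
shift-cancel (suc a) f n = shift-cancel a f n

shift-< : ∀ {a n} f → n < a → shift a f n ≡ 0ℤ
shift-< {suc a} {zero}  f _         = refl
shift-< {suc a} {suc n} f (s≤s n<a) = shift-< f n<a

shift-cong : ∀ a {f g} n → (∀ {i} → i ≤ n → f i ≡ g i) → shift a f n ≡ shift a g n
shift-cong zero    n       f≡g = f≡g ℕ.≤-refl
shift-cong (suc a) zero    f≡g = refl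
shift-cong (suc a) (suc n) f≡g = shift-cong a n (λ i≤n → f≡g (ℕ.m≤n⇒m≤1+n i≤n))

shift-zero : ∀ a n → shift a (λ _ → 0ℤ) n ≡ 0ℤ
shift-zero zero    n       = refl
shift-zero (suc a) zero    = refl
shift-zero (suc a) (suc n) = shift-zero a n

shift-map : ∀ a (φ : ℤ → ℤ) → φ 0ℤ ≡ 0ℤ → ∀ f n → shift a (φ ∘ f) n ≡ φ (shift a f n)
shift-map zero    φ φ0 f n       = refl
shift-map (suc a) φ φ0 f zero    = sym φ0
shift-map (suc a) φ φ0 f (suc n) = shift-map a φ φ0 f n

shift-map₂ : ∀ a (φ : ℤ → ℤ → ℤ) → φ 0ℤ 0ℤ ≡ 0ℤ →
             ∀ f g n → shift a (λ i → φ (f i) (g i)) n ≡ φ (shift a f n) (shift a g n)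
shift-map₂ zero    φ φ0 f g n       = refl
shift-map₂ (suc a) φ φ0 f g zero    = sym φ0
shift-map₂ (suc a) φ φ0 f g (suc n) = shift-map₂ a φ φ0 f g n

when : ∀ {P : Set} → Dec P → ℤ → ℤ
when d x = if does d then x else 0ℤ

when-map : ∀ {P : Set} (d : Dec P) (φ : ℤ → ℤ) → φ 0ℤ ≡ 0ℤ →
           ∀ x → when d (φ x) ≡ φ (when d x)
when-map d φ φ0 x with does d
... | true  = refl
... | false = sym φ0

when-zero : ∀ {P : Set} (d : Dec P) → when d 0ℤ ≡ 0ℤ
when-zero d with does d
... | true  = refl
... | false = refl

when-×-dec : ∀ {P Q : Set} (p : Dec P) (q : Dec Q) x → when (p ×-dec q) x ≡ when q (when p x)
when-×-dec p q x with does p | does q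
... | true  | true  = refl
... | true  | false = refl
... | false | true  = refl
... | false | false = refl

when-subst : ∀ {x y : ℕ} (d : Dec (x ≡ y)) (F : ℕ → ℤ) → when d (F x) ≡ when d (F y)
when-subst (yes refl) F = refl
when-subst (no _)     F = refl

when-+≟ : ∀ a x n c → when (a + x ≟ n) c ≡ shift a (λ t → when (x ≟ t) c) n
when-+≟ zero    x n       c = refl
when-+≟ (suc a) x zero    c = refl
when-+≟ (suc a) x (suc n) c = when-+≟ a x n c

-- A foldr, so that parityCount xs is definitionally ∑ xs (sgn ∘ totalParts).
∑ : List A → (A → ℤ) → ℤ
∑ xs f = foldr (λ x acc → f x ℤ.+ acc) 0ℤ xs

infix 5 ∑
syntax ∑ xs (λ x → e) = ∑[ x ∈ xs ] e

∑-cong : ∀ (xs : List A) {f g} → (∀ x → f x ≡ g x) → ∑ xs f ≡ ∑ xs g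
∑-cong []       f≡g = refl
∑-cong (x ∷ xs) f≡g = cong₂ ℤ._+_ (f≡g x) (∑-cong xs f≡g)

∑-++ : ∀ (xs ys : List A) f → ∑ (xs ++ ys) f ≡ ∑ xs f ℤ.+ ∑ ys f
∑-++ []       ys f = sym (ℤ.+-identityˡ _)
∑-++ (x ∷ xs) ys f = trans (cong (λ s → f x ℤ.+ s) (∑-++ xs ys f)) (sym (ℤ.+-assoc (f x) _ _))

∑-map : ∀ (g : A → B) (xs : List A) f → ∑ (map g xs) f ≡ ∑ xs (f ∘ g)
∑-map g []       f = refl
∑-map g (x ∷ xs) f = cong (λ s → f (g x) ℤ.+ s) (∑-map g xs f)

∑-zero : ∀ (xs : List A) → ∑[ x ∈ xs ] 0ℤ ≡ 0ℤ
∑-zero []       = refl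
∑-zero (x ∷ xs) = trans (ℤ.+-identityˡ _) (∑-zero xs)

∑-map-homo : ∀ (φ : ℤ → ℤ) → φ 0ℤ ≡ 0ℤ → (∀ x y → φ (x ℤ.+ y) ≡ φ x ℤ.+ φ y) →
             ∀ (xs : List A) f → ∑ xs (φ ∘ f) ≡ φ (∑ xs f)
∑-map-homo φ φ0 φ+ []       f = sym φ0
∑-map-homo φ φ0 φ+ (x ∷ xs) f =
  trans (cong (λ s → φ (f x) ℤ.+ s) (∑-map-homo φ φ0 φ+ xs f)) (sym (φ+ (f x) (∑ xs f)))

∑-* : ∀ c (xs : List A) f → ∑[ x ∈ xs ] c ℤ.* f x ≡ c ℤ.* ∑ xs f
∑-* c = ∑-map-homo (c ℤ.*_) (ℤ.*-zeroʳ c) (ℤ.*-distribˡ-+ c)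

∑-filter : ∀ {P : A → Set} (P? : Decidable P) (xs : List A) f →
           ∑ (filter P? xs) f ≡ ∑[ x ∈ xs ] when (P? x) (f x)
∑-filter P? []       f = refl
∑-filter P? (x ∷ xs) f with does (P? x)
... | true  = cong (λ s → f x ℤ.+ s) (∑-filter P? xs f)
... | false = trans (∑-filter P? xs f) (sym (ℤ.+-identityˡ _))

∑-cartesianProduct : ∀ (xs : List A) (ys : List B) f →
  ∑ (cartesianProduct xs ys) f ≡ ∑[ x ∈ xs ] ∑[ y ∈ ys ] f (x , y)
∑-cartesianProduct []       ys f = refl
∑-cartesianProduct (x ∷ xs) ys f = trans (∑-++ (map (x ,_) ys) _ f)
  (cong₂ ℤ._+_ (∑-map (x ,_) ys f) (∑-cartesianProduct xs ys f))

shift-∑ : ∀ a (xs : List A) (f : A → Series) n →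
          shift a (λ i → ∑[ x ∈ xs ] f x i) n ≡ ∑[ x ∈ xs ] shift a (f x) n
shift-∑ a []       f n = shift-zero a n
shift-∑ a (x ∷ xs) f n = trans (shift-map₂ a ℤ._+_ refl (f x) _ n)
  (cong (λ s → shift a (f x) n ℤ.+ s) (shift-∑ a xs f n))

∑-subsets : ∀ n f →
  ∑ (subsets (suc n)) f ≡ (∑[ r ∈ subsets n ] f (false ∷ r)) ℤ.+ (∑[ r ∈ subsets n ] f (true ∷ r))
∑-subsets n f = trans (∑-++ (map (false ∷_) (subsets n)) _ f)
  (cong₂ ℤ._+_ (∑-map (false ∷_) (subsets n) f) (∑-map (true ∷_) (subsets n) f))

⟦_⟧ : Poly → Series
⟦ p ⟧ n = coeff n p

coeff-[] : ∀ n → coeff n [] ≡ 0ℤ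
coeff-[] zero    = refl
coeff-[] (suc n) = refl

coeff-⊕ : ∀ p q n → coeff n (p ⊕ q) ≡ coeff n p ℤ.+ coeff n q
coeff-⊕ []      q       n       = sym (trans (cong (ℤ._+ coeff n q) (coeff-[] n)) (ℤ.+-identityˡ _))
coeff-⊕ (a ∷ p) []      n       =
  sym (trans (cong (λ s → coeff n (a ∷ p) ℤ.+ s) (coeff-[] n)) (ℤ.+-identityʳ _))
coeff-⊕ (a ∷ p) (b ∷ q) zero    = refl
coeff-⊕ (a ∷ p) (b ∷ q) (suc n) = coeff-⊕ p q n

coeff-scale : ∀ c p n → coeff n (scale c p) ≡ c ℤ.* coeff n p
coeff-scale c []      n       = trans (coeff-[] n) (sym (trans (cong (c ℤ.*_) (coeff-[] n)) (ℤ.*-zeroʳ c)))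
coeff-scale c (a ∷ p) zero    = refl
coeff-scale c (a ∷ p) (suc n) = coeff-scale c p n

coeff-∷-⊗ : ∀ a p Q n → coeff n ((a ∷ p) ⊗ Q) ≡ a ℤ.* coeff n Q ℤ.+ shift 1 ⟦ p ⊗ Q ⟧ n
coeff-∷-⊗ a p Q n = trans (coeff-⊕ (scale a Q) (0ℤ ∷ (p ⊗ Q)) n)
  (cong₂ ℤ._+_ (coeff-scale a Q n) (coeff-0∷ n))
  where
  coeff-0∷ : ∀ n → coeff n (0ℤ ∷ (p ⊗ Q)) ≡ shift 1 ⟦ p ⊗ Q ⟧ n
  coeff-0∷ zero    = refl
  coeff-0∷ (suc n) = refl

coeff-⊕-⊗ : ∀ p p' Q n → coeff n ((p ⊕ p') ⊗ Q) ≡ coeff n (p ⊗ Q) ℤ.+ coeff n (p' ⊗ Q)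
coeff-⊕-⊗ []      p'       Q n = sym (trans (cong (ℤ._+ coeff n (p' ⊗ Q)) (coeff-[] n)) (ℤ.+-identityˡ _))
coeff-⊕-⊗ (a ∷ p) []       Q n =
  sym (trans (cong (λ s → coeff n ((a ∷ p) ⊗ Q) ℤ.+ s) (coeff-[] n)) (ℤ.+-identityʳ _))
coeff-⊕-⊗ (a ∷ p) (b ∷ p') Q n = begin
  coeff n (((a ℤ.+ b) ∷ (p ⊕ p')) ⊗ Q)
    ≡⟨ coeff-∷-⊗ (a ℤ.+ b) (p ⊕ p') Q n ⟩
  (a ℤ.+ b) ℤ.* coeff n Q ℤ.+ shift 1 ⟦ (p ⊕ p') ⊗ Q ⟧ n
    ≡⟨ cong (λ s → (a ℤ.+ b) ℤ.* coeff n Q ℤ.+ s)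
            (trans (shift-cong 1 n λ {i} _ → coeff-⊕-⊗ p p' Q i) (shift-map₂ 1 ℤ._+_ refl _ _ n)) ⟩
  (a ℤ.+ b) ℤ.* coeff n Q ℤ.+ (shift 1 ⟦ p ⊗ Q ⟧ n ℤ.+ shift 1 ⟦ p' ⊗ Q ⟧ n)
    ≡⟨ distrib a b (coeff n Q) _ _ ⟩
  (a ℤ.* coeff n Q ℤ.+ shift 1 ⟦ p ⊗ Q ⟧ n) ℤ.+ (b ℤ.* coeff n Q ℤ.+ shift 1 ⟦ p' ⊗ Q ⟧ n)
    ≡⟨ sym (cong₂ ℤ._+_ (coeff-∷-⊗ a p Q n) (coeff-∷-⊗ b p' Q n)) ⟩
  coeff n ((a ∷ p) ⊗ Q) ℤ.+ coeff n ((b ∷ p') ⊗ Q) ∎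
  where
  open ≡-Reasoning
  distrib : ∀ a b c x y → (a ℤ.+ b) ℤ.* c ℤ.+ (x ℤ.+ y) ≡ (a ℤ.* c ℤ.+ x) ℤ.+ (b ℤ.* c ℤ.+ y)
  distrib = solve-∀

coeff-scale-⊗ : ∀ c p Q n → coeff n (scale c p ⊗ Q) ≡ c ℤ.* coeff n (p ⊗ Q)
coeff-scale-⊗ c []      Q n = trans (coeff-[] n) (sym (trans (cong (c ℤ.*_) (coeff-[] n)) (ℤ.*-zeroʳ c)))
coeff-scale-⊗ c (a ∷ p) Q n = begin
  coeff n ((c ℤ.* a ∷ scale c p) ⊗ Q)
    ≡⟨ coeff-∷-⊗ (c ℤ.* a) (scale c p) Q n ⟩
  c ℤ.* a ℤ.* coeff n Q ℤ.+ shift 1 ⟦ scale c p ⊗ Q ⟧ n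
    ≡⟨ cong (λ s → c ℤ.* a ℤ.* coeff n Q ℤ.+ s)
            (trans (shift-cong 1 n λ {i} _ → coeff-scale-⊗ c p Q i)
                   (shift-map 1 (c ℤ.*_) (ℤ.*-zeroʳ c) _ n)) ⟩
  c ℤ.* a ℤ.* coeff n Q ℤ.+ c ℤ.* shift 1 ⟦ p ⊗ Q ⟧ n
    ≡⟨ distrib c a (coeff n Q) _ ⟩
  c ℤ.* (a ℤ.* coeff n Q ℤ.+ shift 1 ⟦ p ⊗ Q ⟧ n)
    ≡⟨ cong (c ℤ.*_) (sym (coeff-∷-⊗ a p Q n)) ⟩
  c ℤ.* coeff n ((a ∷ p) ⊗ Q) ∎
  where
  open ≡-Reasoning
  distrib : ∀ c a x y → c ℤ.* a ℤ.* x ℤ.+ c ℤ.* y ≡ c ℤ.* (a ℤ.* x ℤ.+ y)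
  distrib = solve-∀

coeff-const-⊗ : ∀ c Q n → coeff n (const c ⊗ Q) ≡ c ℤ.* coeff n Q
coeff-const-⊗ c Q n = trans (coeff-∷-⊗ c [] Q n)
  (trans (cong (λ s → c ℤ.* coeff n Q ℤ.+ s) (trans (shift-cong 1 n λ {i} _ → coeff-[] i) (shift-zero 1 n)))
         (ℤ.+-identityʳ _))

coeff-qPow-⊗ : ∀ a Q n → coeff n (qPow a ⊗ Q) ≡ shift a ⟦ Q ⟧ n
coeff-qPow-⊗ zero    Q n = trans (coeff-const-⊗ 1ℤ Q n) (ℤ.*-identityˡ _)
coeff-qPow-⊗ (suc a) Q n = begin
  coeff n ((0ℤ ∷ qPow a) ⊗ Q)
    ≡⟨ coeff-∷-⊗ 0ℤ (qPow a) Q n ⟩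
  0ℤ ℤ.* coeff n Q ℤ.+ shift 1 ⟦ qPow a ⊗ Q ⟧ n
    ≡⟨ cong (ℤ._+ shift 1 ⟦ qPow a ⊗ Q ⟧ n) (ℤ.*-zeroˡ (coeff n Q)) ⟩
  0ℤ ℤ.+ shift 1 ⟦ qPow a ⊗ Q ⟧ n
    ≡⟨ ℤ.+-identityˡ _ ⟩
  shift 1 ⟦ qPow a ⊗ Q ⟧ n
    ≡⟨ shift-cong 1 n (λ {i} _ → coeff-qPow-⊗ a Q i) ⟩
  shift 1 (shift a ⟦ Q ⟧) n
    ≡⟨ sym (shift-+ 1 a ⟦ Q ⟧ n) ⟩
  shift (suc a) ⟦ Q ⟧ n ∎
  where open ≡-Reasoning

coeff-monomial-⊗ : ∀ c a Q n → coeff n ((const c ⊗ qPow a) ⊗ Q) ≡ c ℤ.* shift a ⟦ Q ⟧ n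
coeff-monomial-⊗ c a Q n = begin
  coeff n ((scale c (qPow a) ⊕ const 0ℤ) ⊗ Q)
    ≡⟨ coeff-⊕-⊗ (scale c (qPow a)) (const 0ℤ) Q n ⟩
  coeff n (scale c (qPow a) ⊗ Q) ℤ.+ coeff n (const 0ℤ ⊗ Q)
    ≡⟨ cong₂ ℤ._+_ (coeff-scale-⊗ c (qPow a) Q n) (coeff-const-⊗ 0ℤ Q n) ⟩
  c ℤ.* coeff n (qPow a ⊗ Q) ℤ.+ 0ℤ ℤ.* coeff n Q
    ≡⟨ cong₂ ℤ._+_ (cong (c ℤ.*_) (coeff-qPow-⊗ a Q n)) (ℤ.*-zeroˡ (coeff n Q)) ⟩
  c ℤ.* shift a ⟦ Q ⟧ n ℤ.+ 0ℤ
    ≡⟨ ℤ.+-identityʳ _ ⟩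
  c ℤ.* shift a ⟦ Q ⟧ n ∎
  where open ≡-Reasoning

∏1-q^ : List ℕ → Series
∏1-q^ []      zero    = 1ℤ
∏1-q^ []      (suc n) = 0ℤ
∏1-q^ (a ∷ l) n       = ∏1-q^ l n ℤ.- shift a (∏1-q^ l) n

eulerFactor : ℕ → Poly
eulerFactor a = const 1ℤ ⊕ const -1ℤ ⊗ qPow a

coeff-eulerFactor-⊗ : ∀ a Q n → coeff n (eulerFactor a ⊗ Q) ≡ coeff n Q ℤ.- shift a ⟦ Q ⟧ n
coeff-eulerFactor-⊗ a Q n = begin
  coeff n (eulerFactor a ⊗ Q)
    ≡⟨ coeff-⊕-⊗ (const 1ℤ) (const -1ℤ ⊗ qPow a) Q n ⟩
  coeff n (const 1ℤ ⊗ Q) ℤ.+ coeff n ((const -1ℤ ⊗ qPow a) ⊗ Q)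
    ≡⟨ cong₂ ℤ._+_ (trans (coeff-const-⊗ 1ℤ Q n) (ℤ.*-identityˡ _))
                   (coeff-monomial-⊗ -1ℤ a Q n) ⟩
  coeff n Q ℤ.+ -1ℤ ℤ.* shift a ⟦ Q ⟧ n
    ≡⟨ cong (λ s → coeff n Q ℤ.+ s) (ℤ.-1*i≡-i _) ⟩
  coeff n Q ℤ.- shift a ⟦ Q ⟧ n ∎
  where open ≡-Reasoning

coeff-polyProduct : ∀ l n → coeff n (polyProduct (map eulerFactor l)) ≡ ∏1-q^ l n
coeff-polyProduct []      zero    = refl
coeff-polyProduct []      (suc n) = refl
coeff-polyProduct (a ∷ l) n = trans (coeff-eulerFactor-⊗ a (polyProduct (map eulerFactor l)) n)
  (cong₂ ℤ._-_ (coeff-polyProduct l n) (shift-cong a n λ {i} _ → coeff-polyProduct l i))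

∏1-q^-∷-cong : ∀ a {l l'} → (∀ n → ∏1-q^ l n ≡ ∏1-q^ l' n) →
               ∀ n → ∏1-q^ (a ∷ l) n ≡ ∏1-q^ (a ∷ l') n
∏1-q^-∷-cong a {l} {l'} l≡l' n = cong₂ ℤ._-_ (l≡l' n) (shift-cong a n λ {i} _ → l≡l' i)

∏1-q^-swap : ∀ a b l n → ∏1-q^ (a ∷ b ∷ l) n ≡ ∏1-q^ (b ∷ a ∷ l) n
∏1-q^-swap a b l n = begin
  (P n ℤ.- shift b P n) ℤ.- shift a (λ i → P i ℤ.- shift b P i) n
    ≡⟨ cong (λ s → (P n ℤ.- shift b P n) ℤ.- s) (shift-map₂ a ℤ._-_ refl P (shift b P) n) ⟩
  (P n ℤ.- shift b P n) ℤ.- (shift a P n ℤ.- shift a (shift b P) n)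
    ≡⟨ cong (λ s → (P n ℤ.- shift b P n) ℤ.- (shift a P n ℤ.- s)) (shift-comm a b P n) ⟩
  (P n ℤ.- shift b P n) ℤ.- (shift a P n ℤ.- shift b (shift a P) n)
    ≡⟨ exchange (P n) (shift a P n) (shift b P n) (shift b (shift a P) n) ⟩
  (P n ℤ.- shift a P n) ℤ.- (shift b P n ℤ.- shift b (shift a P) n)
    ≡⟨ cong (λ s → (P n ℤ.- shift a P n) ℤ.- s) (sym (shift-map₂ b ℤ._-_ refl P (shift a P) n)) ⟩
  (P n ℤ.- shift a P n) ℤ.- shift b (λ i → P i ℤ.- shift a P i) n ∎
  where
  open ≡-Reasoning
  P = ∏1-q^ l
  exchange : ∀ x u v w → (x ℤ.- v) ℤ.- (u ℤ.- w) ≡ (x ℤ.- u) ℤ.- (v ℤ.- w)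
  exchange = solve-∀

∏1-q^-↭ : ∀ {l l'} → l ↭ l' → ∀ n → ∏1-q^ l n ≡ ∏1-q^ l' n
∏1-q^-↭ ↭.refl n = refl
∏1-q^-↭ {a ∷ l} {a ∷ l'} (prep a l↭l') n = ∏1-q^-∷-cong a {l} {l'} (∏1-q^-↭ l↭l') n
∏1-q^-↭ {a ∷ b ∷ l} {b ∷ a ∷ l'} (swap a b l↭l') n =
  trans (∏1-q^-swap a b l n)
        (∏1-q^-∷-cong b {a ∷ l} {a ∷ l'} (∏1-q^-∷-cong a {l} {l'} (∏1-q^-↭ l↭l')) n)
∏1-q^-↭ (↭.trans l↭l' l'↭l'') n = trans (∏1-q^-↭ l↭l' n) (∏1-q^-↭ l'↭l'' n)

∏1-q^-vanish : ∀ l {n} → sum l < n → ∏1-q^ l n ≡ 0ℤ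
∏1-q^-vanish []      {suc n} _ = refl
∏1-q^-vanish (a ∷ l) {n} a+l<n =
  cong₂ ℤ._-_ (∏1-q^-vanish l (ℕ.≤-<-trans (ℕ.m≤n+m (sum l) a) a+l<n)) (shifted (split a n) a+l<n)
  where
  shifted : ∀ {n} → Split a n → a + sum l < n → shift a (∏1-q^ l) n ≡ 0ℤ
  shifted (below n<a) _         = shift-< (∏1-q^ l) n<a
  shifted (above e)   a+l<a+e =
    trans (shift-cancel a (∏1-q^ l) e) (∏1-q^-vanish l (ℕ.+-cancelˡ-< a _ _ a+l<a+e))

reflect-shift : ∀ {P : Series} {s σ} → (∀ {u v} → u + v ≡ s → P u ≡ σ ℤ.* P v) →
                (∀ {u} → s < u → P u ≡ 0ℤ) →
                ∀ a {x} y → x + y ≡ a + s → P x ≡ σ ℤ.* shift a P y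
reflect-shift {P} {s} {σ} reflect vanish a {x} y x+y≡a+s with split a y
... | above e   = trans (reflect x+e≡s) (cong (σ ℤ.*_) (sym (shift-cancel a P e)))
  where
  x+e≡s : x + e ≡ s
  x+e≡s = ℕ.+-cancelˡ-≡ a _ _ (trans (x+[y+z]≡y+[x+z] a x e) x+y≡a+s)
... | below y<a = trans (vanish s<x) (sym (trans (cong (σ ℤ.*_) (shift-< P y<a)) (ℤ.*-zeroʳ σ)))
  where
  s<x : s < x
  s<x = ℕ.+-cancelˡ-< a s x (begin-strict
    a + s  ≡⟨ sym x+y≡a+s ⟩
    x + y  <⟨ ℕ.+-monoʳ-< x y<a ⟩
    x + a  ≡⟨ ℕ.+-comm x a ⟩
    a + x  ∎)
    where open ℕ.≤-Reasoning

∏1-q^-reflect : ∀ l {x y} → x + y ≡ sum l → ∏1-q^ l x ≡ sgn (length l) ℤ.* ∏1-q^ l y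
∏1-q^-reflect []      {zero}  {zero} _ = refl
∏1-q^-reflect (a ∷ l) {x}     {y}    x+y≡ = begin
  P x ℤ.- shift a P x
    ≡⟨ cong₂ ℤ._-_ (half y x+y≡) (flip (half x (trans (ℕ.+-comm y x) x+y≡))) ⟩
  σ ℤ.* shift a P y ℤ.- σ ℤ.* P y
    ≡⟨ factor σ (shift a P y) (P y) ⟩
  - σ ℤ.* (P y ℤ.- shift a P y) ∎
  where
  open ≡-Reasoning
  P = ∏1-q^ l
  σ = sgn (length l)
  half : ∀ {u} v → u + v ≡ a + sum l → P u ≡ σ ℤ.* shift a P v
  half = reflect-shift {P} {sum l} {σ} (∏1-q^-reflect l) (∏1-q^-vanish l) a
  flip : ∀ {u v} → u ≡ σ ℤ.* v → v ≡ σ ℤ.* u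
  flip {u} {v} u≡σv = sym (trans (cong (σ ℤ.*_) u≡σv)
    (trans (sym (ℤ.*-assoc σ σ v)) (trans (cong (ℤ._* v) (sgn*sgn (length l))) (ℤ.*-identityˡ v))))
  factor : ∀ s u v → s ℤ.* u ℤ.- s ℤ.* v ≡ - s ℤ.* (v ℤ.- u)
  factor = solve-∀

consecutive : ℕ → ℕ → List ℕ
consecutive a zero    = []
consecutive a (suc t) = a ∷ consecutive (suc a) t

length-consecutive : ∀ a t → length (consecutive a t) ≡ t
length-consecutive a zero    = refl
length-consecutive a (suc t) = cong suc (length-consecutive (suc a) t)

consecutive-suc-↭ : ∀ a t → consecutive a (suc t) ↭ (a + t) ∷ consecutive a t
consecutive-suc-↭ a zero    = ↭-reflexive (cong (_∷ []) (sym (ℕ.+-identityʳ a)))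
consecutive-suc-↭ a (suc t) = ↭-trans (prep a (consecutive-suc-↭ (suc a) t))
  (↭-trans (swap a (suc a + t) ↭.refl) (↭-reflexive (cong (_∷ consecutive a (suc t)) (sym (ℕ.+-suc a t)))))

applyUpTo-↭-consecutive : ∀ k t (f : ℕ → ℕ) → (∀ {j} → j < t → f j ≡ k + (t ∸ j)) →
                          applyUpTo f t ↭ consecutive (suc k) t
applyUpTo-↭-consecutive k zero    f f≡ = ↭.refl
applyUpTo-↭-consecutive k (suc t) f f≡ = ↭-trans
  (↭-reflexive (cong (_∷ applyUpTo (f ∘ suc) t) (trans (f≡ (s≤s z≤n)) (ℕ.+-suc k t))))
  (↭-trans (prep (suc k + t) (applyUpTo-↭-consecutive k t (f ∘ suc) (λ j<t → f≡ (s≤s j<t))))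
           (↭-sym (consecutive-suc-↭ (suc k) t)))

upTo-↭-consecutive : ∀ {k m} → k ≤ m → map (m ∸_) (upTo (m ∸ k)) ↭ consecutive (suc k) (m ∸ k)
upTo-↭-consecutive {k} {m} k≤m = ↭-trans (↭-reflexive (map-upTo (m ∸_) (m ∸ k)))
  (applyUpTo-↭-consecutive k (m ∸ k) (m ∸_) λ {j} j<t →
    trans (cong (_∸ j) (sym (ℕ.m+[n∸m]≡n k≤m))) (ℕ.+-∸-assoc k (ℕ.<⇒≤ j<t)))

∏1-q^-consecutive-extend : ∀ a t u {n} → n < a + t →
  ∏1-q^ (consecutive a (u + t)) n ≡ ∏1-q^ (consecutive a t) n
∏1-q^-consecutive-extend a t zero    n<a+t = refl
∏1-q^-consecutive-extend a t (suc u) {n} n<a+t = begin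
  ∏1-q^ (consecutive a (suc (u + t))) n
    ≡⟨ ∏1-q^-↭ (consecutive-suc-↭ a (u + t)) n ⟩
  P n ℤ.- shift (a + (u + t)) P n
    ≡⟨ cong (λ z → P n ℤ.- z) (shift-< P (ℕ.<-≤-trans n<a+t (ℕ.+-monoʳ-≤ a (ℕ.m≤n+m t u)))) ⟩
  P n ℤ.+ 0ℤ
    ≡⟨ ℤ.+-identityʳ (P n) ⟩
  P n
    ≡⟨ ∏1-q^-consecutive-extend a t u n<a+t ⟩
  ∏1-q^ (consecutive a t) n ∎
  where
  open ≡-Reasoning
  P = ∏1-q^ (consecutive a (u + t))

-- Coefficients of ∏_{i > k} (1 - q^i): only the factors with i ≤ k + d matter for q^d.
∏1-q^> : ℕ → Series
∏1-q^> k d = ∏1-q^ (consecutive (suc k) d) d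

∏1-q^>-stable : ∀ k t {n} → n ≤ k + t → ∏1-q^ (consecutive (suc k) t) n ≡ ∏1-q^> k n
∏1-q^>-stable k t {n} n≤k+t = begin
  ∏1-q^ (consecutive (suc k) t) n
    ≡⟨ sym (∏1-q^-consecutive-extend (suc k) t n (s≤s n≤k+t)) ⟩
  ∏1-q^ (consecutive (suc k) (n + t)) n
    ≡⟨ cong (λ u → ∏1-q^ (consecutive (suc k) u) n) (ℕ.+-comm n t) ⟩
  ∏1-q^ (consecutive (suc k) (t + n)) n
    ≡⟨ ∏1-q^-consecutive-extend (suc k) n t (s≤s (ℕ.m≤n+m n k)) ⟩
  ∏1-q^> k n ∎
  where open ≡-Reasoning

∏1-q^>-suc : ∀ k n → ∏1-q^> k n ≡ ∏1-q^> (suc k) n ℤ.- shift (suc k) (∏1-q^> (suc k)) n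
∏1-q^>-suc k n = trans (sym (∏1-q^>-stable k (suc n) (ℕ.≤-trans (ℕ.n≤1+n n) (ℕ.m≤n+m (suc n) k))))
  (cong (λ z → ∏1-q^> (suc k) n ℤ.- z)
        (shift-cong (suc k) n λ {i} i≤n →
           ∏1-q^>-stable (suc k) n (ℕ.≤-trans i≤n (ℕ.m≤n+m n (suc k)))))

triangular : ℕ → ℕ
triangular zero    = 0
triangular (suc k) = suc k + triangular k

n≤triangular : ∀ n → n ≤ triangular n
n≤triangular zero    = z≤n
n≤triangular (suc n) = ℕ.m≤m+n (suc n) (triangular n)

triangular-+ : ∀ k t → triangular (k + t) ≡ triangular k + sum (consecutive (suc k) t)
triangular-+ k zero    = trans (cong triangular (ℕ.+-identityʳ k)) (sym (ℕ.+-identityʳ _))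
triangular-+ k (suc t) = begin
  triangular (k + suc t)           ≡⟨ cong triangular (ℕ.+-suc k t) ⟩
  triangular (suc k + t)           ≡⟨ triangular-+ (suc k) t ⟩
  suc k + triangular k + s         ≡⟨ cong (_+ s) (ℕ.+-comm (suc k) (triangular k)) ⟩
  triangular k + suc k + s         ≡⟨ ℕ.+-assoc (triangular k) (suc k) s ⟩
  triangular k + (suc k + s)       ∎
  where
  open ≡-Reasoning
  s = sum (consecutive (suc (suc k)) t)

triangular*2 : ∀ n → triangular n * 2 ≡ suc n * n
triangular*2 zero    = refl
triangular*2 (suc n) = trans (ℕ.*-distribʳ-+ 2 (suc n) (triangular n))
  (trans (cong (suc n * 2 +_) (triangular*2 n)) (identity n))
  where
  identity : ∀ n → suc n * 2 + suc n * n ≡ suc (suc n) * suc n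
  identity = ℕ-Solver.solve-∀

triangular-half : ∀ n → (suc n * n) / 2 ≡ triangular n
triangular-half n = trans (cong (_/ 2) (sym (triangular*2 n))) (m*n/n≡m (triangular n) 2)

square≡triangular+triangular : ∀ n → suc n * suc n ≡ triangular n + triangular (suc n)
square≡triangular+triangular n = begin
  suc n * suc n               ≡⟨ expand n ⟩
  suc n + suc n * n           ≡⟨ cong (suc n +_) (sym (triangular*2 n)) ⟩
  suc n + triangular n * 2    ≡⟨ arrange (suc n) (triangular n) ⟩
  triangular n + triangular (suc n) ∎
  where
  open ≡-Reasoning
  expand : ∀ n → suc n * suc n ≡ suc n + suc n * n
  expand = ℕ-Solver.solve-∀
  arrange : ∀ a b → a + b * 2 ≡ b + (a + b)
  arrange = ℕ-Solver.solve-∀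

-- With V k = q^{T(k)} ∏_{i > k} (1 - q^i) this says V (k + 1) = q^{k+1} (V (k + 1) + V k),
-- the recurrence obtained by removing the part 1 from k + 1 distinct parts and lowering the rest.
shift-∏1-q^>-suc : ∀ k e →
  shift (triangular (suc k)) (∏1-q^> (suc k)) (suc k + e)
    ≡ shift (triangular (suc k)) (∏1-q^> (suc k)) e ℤ.+ shift (triangular k) (∏1-q^> k) e
shift-∏1-q^>-suc k e = begin
  shift (suc k + triangular k) F (suc k + e)
    ≡⟨ shift-+ (suc k) (triangular k) F (suc k + e) ⟩
  shift (suc k) (shift (triangular k) F) (suc k + e)
    ≡⟨ shift-cancel (suc k) (shift (triangular k) F) e ⟩
  shift (triangular k) F e
    ≡⟨ split-off (shift (triangular k) F e) (shift (triangular k) (shift (suc k) F) e) ⟩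
  shift (triangular k) (shift (suc k) F) e
    ℤ.+ (shift (triangular k) F e ℤ.- shift (triangular k) (shift (suc k) F) e)
    ≡⟨ cong₂ ℤ._+_ (trans (shift-comm (triangular k) (suc k) F e) (sym (shift-+ (suc k) (triangular k) F e)))
                   (sym (shift-map₂ (triangular k) ℤ._-_ refl F (shift (suc k) F) e)) ⟩
  shift (triangular (suc k)) F e ℤ.+ shift (triangular k) (λ i → F i ℤ.- shift (suc k) F i) e
    ≡⟨ cong (λ z → shift (triangular (suc k)) F e ℤ.+ z)
            (shift-cong (triangular k) e λ {i} _ → sym (∏1-q^>-suc k i)) ⟩
  shift (triangular (suc k)) F e ℤ.+ shift (triangular k) (∏1-q^> k) e ∎
  where
  open ≡-Reasoning
  F = ∏1-q^> (suc k)
  split-off : ∀ x y → x ≡ y ℤ.+ (x ℤ.- y)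
  split-off = solve-∀

-- Σ_{i ∈ r} (a + i), positions i counted from 0.
offsetSum : ∀ {n} → ℕ → Subset n → ℕ
offsetSum a []          = 0
offsetSum a (false ∷ r) = offsetSum (suc a) r
offsetSum a (true ∷ r)  = a + offsetSum (suc a) r

offsetSum-suc : ∀ {n} a (r : Subset n) → offsetSum (suc a) r ≡ ∣ r ∣ + offsetSum a r
offsetSum-suc a []          = refl
offsetSum-suc a (false ∷ r) = offsetSum-suc (suc a) r
offsetSum-suc a (true ∷ r)  =
  cong suc (trans (cong (a +_) (offsetSum-suc (suc a) r)) (x+[y+z]≡y+[x+z] a ∣ r ∣ _))

sum-tabulate-offsetSum : ∀ {n} a (r : Subset n) →
  sum (tabulate (λ i → if lookup r i then a + toℕ i else 0)) ≡ offsetSum a r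
sum-tabulate-offsetSum-suc : ∀ {n} a (r : Subset n) →
  sum (tabulate (λ i → if lookup r i then a + suc (toℕ i) else 0)) ≡ offsetSum (suc a) r
sum-tabulate-offsetSum a []      = refl
sum-tabulate-offsetSum a (false ∷ r) = sum-tabulate-offsetSum-suc a r
sum-tabulate-offsetSum a (true ∷ r)  = cong₂ _+_ (ℕ.+-identityʳ a) (sum-tabulate-offsetSum-suc a r)

sum-tabulate-offsetSum-suc a r =
  trans (cong sum (tabulate-cong λ i → cong (λ x → if lookup r i then x else 0) (ℕ.+-suc a (toℕ i))))
        (sum-tabulate-offsetSum (suc a) r)

partSum≡offsetSum : ∀ {n} (r : Subset n) → partSum r ≡ offsetSum 1 r
partSum≡offsetSum r =
  trans (cong sum (map-tabulate (λ i → i) (λ i → if lookup r i then suc (toℕ i) else 0)))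
        (sum-tabulate-offsetSum 1 r)

∑-sgn-offsetSum : ∀ n a t →
  (∑[ w ∈ subsets n ] when (offsetSum a w ≟ t) (sgn ∣ w ∣)) ≡ ∏1-q^ (consecutive a n) t
∑-sgn-offsetSum zero    a zero    = refl
∑-sgn-offsetSum zero    a (suc t) = refl
∑-sgn-offsetSum (suc n) a t       = begin
  ∑ (subsets (suc n)) (λ w → when (offsetSum a w ≟ t) (sgn ∣ w ∣))
    ≡⟨ ∑-subsets n (λ w → when (offsetSum a w ≟ t) (sgn ∣ w ∣)) ⟩
  W t ℤ.+ (∑[ w ∈ S ] when (a + offsetSum (suc a) w ≟ t) (- sgn ∣ w ∣))
    ≡⟨ cong (λ z → W t ℤ.+ z) (∑-cong S λ w →
         trans (when-map (a + offsetSum (suc a) w ≟ t) -_ refl (sgn ∣ w ∣))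
               (cong -_ (when-+≟ a (offsetSum (suc a) w) t (sgn ∣ w ∣)))) ⟩
  W t ℤ.+ (∑[ w ∈ S ] - shift a (V w) t)
    ≡⟨ cong (λ z → W t ℤ.+ z) (trans (∑-map-homo -_ refl ℤ.neg-distrib-+ S (λ w → shift a (V w) t))
                                     (cong -_ (sym (shift-∑ a S V t)))) ⟩
  W t ℤ.- shift a W t
    ≡⟨ cong₂ ℤ._-_ (∑-sgn-offsetSum n (suc a) t)
                   (shift-cong a t λ {i} _ → ∑-sgn-offsetSum n (suc a) i) ⟩
  ∏1-q^ (consecutive a (suc n)) t ∎
  where
  open ≡-Reasoning
  S = subsets n
  V : Subset n → Series
  V w i = when (offsetSum (suc a) w ≟ i) (sgn ∣ w ∣)
  W : Series
  W i = ∑[ w ∈ S ] V w i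

partSum-∷ : ∀ {n} b (r : Subset n) → partSum (b ∷ r) ≡ ∣ b ∷ r ∣ + partSum r
partSum-∷ false r = trans (partSum≡offsetSum (false ∷ r))
  (trans (offsetSum-suc 1 r) (cong (∣ r ∣ +_) (sym (partSum≡offsetSum r))))
partSum-∷ true  r = trans (partSum≡offsetSum (true ∷ r))
  (cong suc (trans (offsetSum-suc 1 r) (cong (∣ r ∣ +_) (sym (partSum≡offsetSum r)))))

distinctPartsConv : Series → ℕ → ℕ → Series
distinctPartsConv g a k n = ∑[ r ∈ subsets a ] when (∣ r ∣ ≟ k) (shift (partSum r) g n)

when-shift-partSum-∷ : ∀ {a} b (r : Subset a) j g n →
  when (∣ b ∷ r ∣ ≟ j) (shift (partSum (b ∷ r)) g n)
    ≡ shift j (λ i → when (∣ b ∷ r ∣ ≟ j) (shift (partSum r) g i)) n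
when-shift-partSum-∷ b r j g n = begin
  when d (shift (partSum (b ∷ r)) g n)      ≡⟨ cong (λ c → when d (shift c g n)) (partSum-∷ b r) ⟩
  when d (shift (∣ b ∷ r ∣ + partSum r) g n) ≡⟨ when-subst d (λ c → shift (c + partSum r) g n) ⟩
  when d (shift (j + partSum r) g n)         ≡⟨ cong (when d) (shift-+ j (partSum r) g n) ⟩
  when d (shift j (shift (partSum r) g) n)   ≡⟨ sym (shift-map j (when d) (when-zero d) (shift (partSum r) g) n) ⟩
  shift j (λ i → when d (shift (partSum r) g i)) n ∎
  where
  open ≡-Reasoning
  d = ∣ b ∷ r ∣ ≟ j

distinctPartsConv-zero : ∀ g a n → distinctPartsConv g a 0 n ≡ g n
distinctPartsConv-zero g zero    n = ℤ.+-identityʳ (g n)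
distinctPartsConv-zero g (suc a) n = begin
  distinctPartsConv g (suc a) 0 n
    ≡⟨ ∑-subsets a (λ r → when (∣ r ∣ ≟ 0) (shift (partSum r) g n)) ⟩
  (∑[ r ∈ subsets a ] when (∣ r ∣ ≟ 0) (shift (partSum (false ∷ r)) g n))
    ℤ.+ (∑[ r ∈ subsets a ] 0ℤ)
    ≡⟨ cong₂ ℤ._+_ (∑-cong (subsets a) λ r → when-shift-partSum-∷ false r 0 g n)
                   (∑-zero (subsets a)) ⟩
  distinctPartsConv g a 0 n ℤ.+ 0ℤ
    ≡⟨ trans (ℤ.+-identityʳ _) (distinctPartsConv-zero g a n) ⟩
  g n ∎
  where open ≡-Reasoning

distinctPartsConv-suc : ∀ g a k n →
  distinctPartsConv g (suc a) (suc k) n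
    ≡ shift (suc k) (λ i → distinctPartsConv g a (suc k) i ℤ.+ distinctPartsConv g a k i) n
distinctPartsConv-suc g a k n = begin
  distinctPartsConv g (suc a) (suc k) n
    ≡⟨ ∑-subsets a (λ r → when (∣ r ∣ ≟ suc k) (shift (partSum r) g n)) ⟩
  (∑[ r ∈ S ] when (∣ false ∷ r ∣ ≟ suc k) (shift (partSum (false ∷ r)) g n))
    ℤ.+ (∑[ r ∈ S ] when (∣ true ∷ r ∣ ≟ suc k) (shift (partSum (true ∷ r)) g n))
    ≡⟨ cong₂ ℤ._+_ (peel false) (peel true) ⟩
  shift (suc k) (distinctPartsConv g a (suc k)) n ℤ.+ shift (suc k) (distinctPartsConv g a k) n
    ≡⟨ sym (shift-map₂ (suc k) ℤ._+_ refl _ _ n) ⟩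
  shift (suc k) (λ i → distinctPartsConv g a (suc k) i ℤ.+ distinctPartsConv g a k i) n ∎
  where
  open ≡-Reasoning
  S = subsets a
  peel : ∀ b → (∑[ r ∈ S ] when (∣ b ∷ r ∣ ≟ suc k) (shift (partSum (b ∷ r)) g n))
             ≡ shift (suc k) (λ i → ∑[ r ∈ S ] when (∣ b ∷ r ∣ ≟ suc k) (shift (partSum r) g i)) n
  peel b = trans (∑-cong S λ r → when-shift-partSum-∷ b r (suc k) g n)
                 (sym (shift-∑ (suc k) S (λ r i → when (∣ b ∷ r ∣ ≟ suc k) (shift (partSum r) g i)) n))

-- The coefficient form of Σ_{|r| = k} q^{partSum r} = q^{T(k)} / ∏_{i ≤ k} (1 - q^i),
-- multiplied by ∏_{i ≥ 1} (1 - q^i).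
distinctPartsConv-∏1-q^> : ∀ {g} a k n → n ≤ a → (∀ {i} → i ≤ n → g i ≡ ∏1-q^> 0 i) →
  distinctPartsConv g a k n ≡ shift (triangular k) (∏1-q^> k) n
distinctPartsConv-∏1-q^> {g} a zero n n≤a g≡ = trans (distinctPartsConv-zero g a n) (g≡ ℕ.≤-refl)
distinctPartsConv-∏1-q^> zero    (suc k) zero    z≤n g≡ = refl
distinctPartsConv-∏1-q^> {g} (suc a) (suc k) n n≤a g≡ with split (suc k) n
... | below n<k = trans (distinctPartsConv-suc g a k n)
  (trans (shift-< _ n<k) (sym (shift-< _ (ℕ.<-≤-trans n<k (n≤triangular (suc k))))))
... | above e   = begin
  distinctPartsConv g (suc a) (suc k) (suc k + e)
    ≡⟨ distinctPartsConv-suc g a k (suc k + e) ⟩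
  shift (suc k) (λ i → distinctPartsConv g a (suc k) i ℤ.+ distinctPartsConv g a k i) (suc k + e)
    ≡⟨ shift-cancel (suc k) _ e ⟩
  distinctPartsConv g a (suc k) e ℤ.+ distinctPartsConv g a k e
    ≡⟨ cong₂ ℤ._+_ (distinctPartsConv-∏1-q^> a (suc k) e e≤a g≡′)
                   (distinctPartsConv-∏1-q^> a k e e≤a g≡′) ⟩
  shift (triangular (suc k)) (∏1-q^> (suc k)) e ℤ.+ shift (triangular k) (∏1-q^> k) e
    ≡⟨ sym (shift-∏1-q^>-suc k e) ⟩
  shift (triangular (suc k)) (∏1-q^> (suc k)) (suc k + e) ∎
  where
  open ≡-Reasoning
  e≤a : e ≤ a
  e≤a = ℕ.≤-pred (ℕ.≤-trans (s≤s (ℕ.m≤n+m e k)) n≤a)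
  g≡′ : ∀ {i} → i ≤ e → g i ≡ ∏1-q^> 0 i
  g≡′ i≤e = g≡ (ℕ.≤-trans i≤e (ℕ.m≤n+m e (suc k)))

signedPartSums : ℕ → Series
signedPartSums n t = ∑[ w ∈ subsets n ] when (partSum w ≟ t) (sgn ∣ w ∣)

signedPartSums≡∏1-q^> : ∀ n {t} → t ≤ n → signedPartSums n t ≡ ∏1-q^> 0 t
signedPartSums≡∏1-q^> n {t} t≤n =
  trans (∑-cong (subsets n) λ w → cong (λ s → when (s ≟ t) (sgn ∣ w ∣)) (partSum≡offsetSum w))
        (trans (∑-sgn-offsetSum n 1 t) (∏1-q^>-stable 0 n t≤n))

∑-white : ∀ h k {n} (r : Subset n) (d : Dec (∣ r ∣ ≡ k)) →
  (∑[ w ∈ subsets n ] when d (when (partSum r + partSum w ≟ h) (sgn (∣ r ∣ + ∣ w ∣))))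
    ≡ sgn k ℤ.* when d (shift (partSum r) (signedPartSums n) h)
∑-white h k {n} r (no _)        = trans (∑-zero (subsets n)) (sym (ℤ.*-zeroʳ (sgn k)))
∑-white h k {n} r (yes ∣r∣≡k) = begin
  (∑[ w ∈ S ] when (partSum r + partSum w ≟ h) (sgn (∣ r ∣ + ∣ w ∣)))
    ≡⟨ ∑-cong S (λ w → trans (cong (when (partSum r + partSum w ≟ h)) (sgn-split w))
         (when-map (partSum r + partSum w ≟ h) (sgn k ℤ.*_) (ℤ.*-zeroʳ (sgn k)) (sgn ∣ w ∣))) ⟩
  (∑[ w ∈ S ] sgn k ℤ.* when (partSum r + partSum w ≟ h) (sgn ∣ w ∣))
    ≡⟨ ∑-* (sgn k) S (λ w → when (partSum r + partSum w ≟ h) (sgn ∣ w ∣)) ⟩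
  sgn k ℤ.* (∑[ w ∈ S ] when (partSum r + partSum w ≟ h) (sgn ∣ w ∣))
    ≡⟨ cong (sgn k ℤ.*_) (∑-cong S λ w → when-+≟ (partSum r) (partSum w) h (sgn ∣ w ∣)) ⟩
  sgn k ℤ.* (∑[ w ∈ S ] shift (partSum r) (λ t → when (partSum w ≟ t) (sgn ∣ w ∣)) h)
    ≡⟨ cong (sgn k ℤ.*_) (sym (shift-∑ (partSum r) S (λ w t → when (partSum w ≟ t) (sgn ∣ w ∣)) h)) ⟩
  sgn k ℤ.* shift (partSum r) (signedPartSums n) h ∎
  where
  open ≡-Reasoning
  S = subsets n
  sgn-split : ∀ w → sgn (∣ r ∣ + ∣ w ∣) ≡ sgn k ℤ.* sgn ∣ w ∣
  sgn-split w = trans (sgn-+ ∣ r ∣ ∣ w ∣) (cong (λ j → sgn j ℤ.* sgn ∣ w ∣) ∣r∣≡k)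

parityCount-D₂ : ∀ h k → parityCount (D₂ h k) ≡ sgn k ℤ.* distinctPartsConv (signedPartSums h) h k h
parityCount-D₂ h k = begin
  parityCount (D₂ h k)
    ≡⟨ ∑-filter P? (cartesianProduct S S) (λ rw → sgn (totalParts rw)) ⟩
  (∑[ rw ∈ cartesianProduct S S ] when (P? rw) (sgn (totalParts rw)))
    ≡⟨ ∑-cartesianProduct S S (λ rw → when (P? rw) (sgn (totalParts rw))) ⟩
  (∑[ r ∈ S ] ∑[ w ∈ S ] when (P? (r , w)) (sgn (∣ r ∣ + ∣ w ∣)))
    ≡⟨ ∑-cong S red ⟩
  (∑[ r ∈ S ] sgn k ℤ.* when (∣ r ∣ ≟ k) (shift (partSum r) (signedPartSums h) h))
    ≡⟨ ∑-* (sgn k) S (λ r → when (∣ r ∣ ≟ k) (shift (partSum r) (signedPartSums h) h)) ⟩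
  sgn k ℤ.* distinctPartsConv (signedPartSums h) h k h ∎
  where
  open ≡-Reasoning
  S = subsets h
  P? : (rw : TwoDistinct h) → Dec (partSum (proj₁ rw) + partSum (proj₂ rw) ≡ h × ∣ proj₁ rw ∣ ≡ k)
  P? rw = (partSum (proj₁ rw) + partSum (proj₂ rw) ≟ h) ×-dec (∣ proj₁ rw ∣ ≟ k)
  red : ∀ r → (∑[ w ∈ S ] when (P? (r , w)) (sgn (∣ r ∣ + ∣ w ∣)))
            ≡ sgn k ℤ.* when (∣ r ∣ ≟ k) (shift (partSum r) (signedPartSums h) h)
  red r = trans (∑-cong S λ w → when-×-dec (partSum r + partSum w ≟ h) (∣ r ∣ ≟ k) (sgn (∣ r ∣ + ∣ w ∣)))
                (∑-white h k r (∣ r ∣ ≟ k))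

∏1-q^-consecutive-complement : ∀ k t {h} → h ≤ k + t →
  ∏1-q^ (consecutive (suc k) t) (triangular (k + t) ∸ h) ≡ sgn t ℤ.* shift (triangular k) (∏1-q^> k) h
∏1-q^-consecutive-complement k t {h} h≤k+t = begin
  ∏1-q^ L (triangular (k + t) ∸ h)
    ≡⟨ reflect-shift {∏1-q^ L} {sum L} {sgn (length L)}
                     (∏1-q^-reflect L) (∏1-q^-vanish L) (triangular k) h complement ⟩
  sgn (length L) ℤ.* shift (triangular k) (∏1-q^ L) h
    ≡⟨ cong₂ (λ j x → sgn j ℤ.* x) (length-consecutive (suc k) t)
             (shift-cong (triangular k) h λ i≤h → ∏1-q^>-stable k t (ℕ.≤-trans i≤h h≤k+t)) ⟩
  sgn t ℤ.* shift (triangular k) (∏1-q^> k) h ∎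
  where
  open ≡-Reasoning
  L = consecutive (suc k) t
  complement : (triangular (k + t) ∸ h) + h ≡ triangular k + sum L
  complement = trans (ℕ.m∸n+n≡m (ℕ.≤-trans h≤k+t (n≤triangular (k + t)))) (triangular-+ k t)

coeff-lemma4Poly : ∀ m h k → h ≤ suc m → k ≤ suc m →
  coeff (suc m * suc m ∸ h) (lemma4Poly (suc m) k) ≡ sgn k ℤ.* shift (triangular k) (∏1-q^> k) h
coeff-lemma4Poly m h k h≤M k≤M = begin
  coeff (M * M ∸ h) (lemma4Poly M k)
    ≡⟨ coeff-monomial-⊗ (sgn M) T P (M * M ∸ h) ⟩
  sgn M ℤ.* shift T ⟦ P ⟧ (M * M ∸ h)
    ≡⟨ cong (sgn M ℤ.*_) (shift-cong T (M * M ∸ h) λ {i} _ → coeff-P i) ⟩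
  sgn M ℤ.* shift T (∏1-q^ L) (M * M ∸ h)
    ≡⟨ cong (λ n → sgn M ℤ.* shift T (∏1-q^ L) n) M*M∸h ⟩
  sgn M ℤ.* shift T (∏1-q^ L) (T + (triangular M ∸ h))
    ≡⟨ cong (sgn M ℤ.*_) (shift-cancel T (∏1-q^ L) (triangular M ∸ h)) ⟩
  sgn M ℤ.* ∏1-q^ L (triangular M ∸ h)
    ≡⟨ cong (λ j → sgn j ℤ.* ∏1-q^ L (triangular j ∸ h)) (sym k+t≡M) ⟩
  sgn (k + t) ℤ.* ∏1-q^ L (triangular (k + t) ∸ h)
    ≡⟨ cong (sgn (k + t) ℤ.*_) (∏1-q^-consecutive-complement k t h≤k+t) ⟩
  sgn (k + t) ℤ.* (sgn t ℤ.* shift (triangular k) (∏1-q^> k) h)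
    ≡⟨ sgn-+-cancelʳ k t _ ⟩
  sgn k ℤ.* shift (triangular k) (∏1-q^> k) h ∎
  where
  open ≡-Reasoning
  M = suc m
  t = M ∸ k
  T = (M * (M ∸ 1)) / 2
  L = consecutive (suc k) t
  P = polyProduct (map (λ j → eulerFactor (M ∸ j)) (upTo t))
  k+t≡M : k + t ≡ M
  k+t≡M = ℕ.m+[n∸m]≡n k≤M
  h≤k+t : h ≤ k + t
  h≤k+t = ℕ.≤-trans h≤M (ℕ.≤-reflexive (sym k+t≡M))
  coeff-P : ∀ i → coeff i P ≡ ∏1-q^ L i
  coeff-P i = trans (cong (λ fs → coeff i (polyProduct fs)) (map-∘ (upTo t)))
    (trans (coeff-polyProduct (map (M ∸_) (upTo t)) i) (∏1-q^-↭ (upTo-↭-consecutive k≤M) i))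
  M*M∸h : M * M ∸ h ≡ T + (triangular M ∸ h)
  M*M∸h = trans (cong (_∸ h) (trans (square≡triangular+triangular m)
                                     (cong (_+ triangular M) (sym (triangular-half m)))))
                (ℕ.+-∸-assoc T (ℕ.≤-trans h≤M (n≤triangular M)))

lemma4 : (m h k : ℕ) → .{{_ : NonZero m}} → h ≤ m → k ≤ m →
    coeff (m * m ∸ h) (lemma4Poly m k) ≡ parityCount (D₂ h k)
lemma4 (suc m) h k h≤m k≤m = begin
  coeff (suc m * suc m ∸ h) (lemma4Poly (suc m) k)
    ≡⟨ coeff-lemma4Poly m h k h≤m k≤m ⟩
  sgn k ℤ.* shift (triangular k) (∏1-q^> k) h
    ≡⟨ cong (sgn k ℤ.*_) (sym (distinctPartsConv-∏1-q^> h k h ℕ.≤-refl (signedPartSums≡∏1-q^> h))) ⟩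
  sgn k ℤ.* distinctPartsConv (signedPartSums h) h k h
    ≡⟨ sym (parityCount-D₂ h k) ⟩
  parityCount (D₂ h k) ∎
  where open ≡-Reasoning
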